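{- Let $M$ be a finite semilattice with separated equalizers. Let $p$ be an irreducible object with predecessor $q$, and let $s$ be a singular object with successor $t$. If $q\mid s$ and $p\nmid s$, then $t=ps$.
   Context: A semilattice here is a commutative monoid (written multiplicatively, with identity) in which every element satisfies $x^2=x$; $x\mid y$ means $xz=y$ for some $z$. An object $p$ is irreducible if $p=yz$ implies $p=y$ or $p=z$; a predecessor of $p$ is an object $q\neq p$ with $q\mid p$ such that every $x$ with $x\mid p$ satisfies $x=p$ or $x\mid q$. An object $s$ is singular with successor $t$ if $t\neq s$, $s\mid t$, and every $x$ with $s\mid x$ satisfies $x=s$ or $t\mid x$. An equalizing pair is a pair $x,y$ with $x\mid y$ for which there exist $a,b$ with $xa\neq xb$, $xa\neq ya$, $ya=yb$, $yb\neq xb$; $M$ has separated equalizers if for each equalizing pair $x,y$ there is $z$ with $x\mid z\mid y$, $z\neq x$, $z\neq y$. -}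

module Defs where

open import Level using (Level)
open import Data.Nat using (ℕ)
open import Data.Fin using (Fin)
open import Data.Product using (Σ; ∃; _×_; _,_)
open import Data.Sum using (_⊎_)
open import Relation.Nullary using (¬_)
open import Relation.Binary.PropositionalEquality using (_≡_)
open import Algebra.Structures using (IsCommutativeMonoid)
open import Algebra.Definitions using (Idempotent)
open import Function.Bundles using (_↔_)

record Semilattice (c : Level) : Set (Level.suc c) where
  infixl 7 _·_
  field
    Carrier  : Set c
    _·_      : Carrier → Carrier → Carrier
    e        : Carrier
    isCommutativeMonoid : IsCommutativeMonoid _≡_ _·_ e
    idem     : Idempotent _≡_ _·_

module SemilatticeNotions {c : Level} (M : Semilattice c) where
  open Semilattice M

  IsFinite : Set c
  IsFinite = Σ ℕ λ n → Carrier ↔ Fin n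

  _∣_ : Carrier → Carrier → Set c
  x ∣ y = Σ Carrier λ z → x · z ≡ y

  Irreducible : Carrier → Set c
  Irreducible p = ∀ y z → p ≡ y · z → p ≡ y ⊎ p ≡ z

  IsPredecessor : Carrier → Carrier → Set c
  IsPredecessor q p = ¬ (q ≡ p) × q ∣ p × (∀ x → x ∣ p → x ≡ p ⊎ x ∣ q)

  IsSingularWithSuccessor : Carrier → Carrier → Set c
  IsSingularWithSuccessor s t = ¬ (t ≡ s) × s ∣ t × (∀ x → s ∣ x → x ≡ s ⊎ t ∣ x)

  EqualizingPair : Carrier → Carrier → Set c
  EqualizingPair x y = x ∣ y × (Σ Carrier λ a → Σ Carrier λ b →
    ¬ (x · a ≡ x · b) × ¬ (x · a ≡ y · a) × y · a ≡ y · b × ¬ (y · b ≡ x · b))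

  HasSeparatedEqualizers : Set c
  HasSeparatedEqualizers = ∀ x y → EqualizingPair x y →
    Σ Carrier λ z → x ∣ z × z ∣ y × ¬ (z ≡ x) × ¬ (z ≡ y)

-- Since s ∣ p · s and p · s ≠ s, singularity gives t ∣ p · s, whence p · t = p · s.
-- If p · t ≠ t, then q ∣ p is an equalizing pair witnessed by a = s, b = t
-- (q fixes both s and t), so separated equalizers would put an object strictly
-- between q and p, which the predecessor q forbids. Hence t = p · t = p · s.
module Submission where

open import Defs
open import Level using (Level)
open import Data.Product using (_,_)
open import Data.Sum using (_⊎_; inj₁; inj₂)
open import Relation.Nullary using (¬_; yes; no; contradiction)
open import Relation.Nullary.Decidable using (via-injection)
open import Relation.Binary.Definitions using (DecidableEquality)
open import Relation.Binary.PropositionalEquality using (_≡_; refl; sym; trans; cong; module ≡-Reasoning)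
open import Algebra.Structures using (IsCommutativeMonoid)
open import Function.Properties.Inverse using (↔⇒↣)
open import Data.Fin.Properties using (_≟_)

module SemilatticeProperties {c : Level} (M : Semilattice c) where
  open Semilattice M
  open SemilatticeNotions M
  open IsCommutativeMonoid isCommutativeMonoid using (assoc; comm)
  open ≡-Reasoning

  finite⇒decidableEquality : IsFinite → DecidableEquality Carrier
  finite⇒decidableEquality (_ , Carrier↔Fin) = via-injection (↔⇒↣ Carrier↔Fin) _≟_

  ∣⇒·≡ʳ : ∀ {x y} → x ∣ y → x · y ≡ y
  ∣⇒·≡ʳ {x} (z , refl) = begin
    x · (x · z) ≡⟨ assoc x x z ⟨
    (x · x) · z ≡⟨ cong (_· z) (idem x) ⟩
    x · z       ∎

  ∣-trans : ∀ {x y z} → x ∣ y → y ∣ z → x ∣ z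
  ∣-trans {x} {y} {z} x∣y y∣z = z , (begin
    x · z       ≡⟨ cong (x ·_) (∣⇒·≡ʳ y∣z) ⟨
    x · (y · z) ≡⟨ assoc x y z ⟨
    (x · y) · z ≡⟨ cong (_· z) (∣⇒·≡ʳ x∣y) ⟩
    y · z       ≡⟨ ∣⇒·≡ʳ y∣z ⟩
    z           ∎)

  ∣-antisym : ∀ {x y} → x ∣ y → y ∣ x → x ≡ y
  ∣-antisym {x} {y} x∣y y∣x = begin
    x     ≡⟨ ∣⇒·≡ʳ y∣x ⟨
    y · x ≡⟨ comm y x ⟩
    x · y ≡⟨ ∣⇒·≡ʳ x∣y ⟩
    y     ∎

  predecessor⇒noObjectBetween : ∀ {q p z} → IsPredecessor q p →
    q ∣ z → z ∣ p → z ≡ q ⊎ z ≡ p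
  predecessor⇒noObjectBetween (_ , _ , below-p) q∣z z∣p with below-p _ z∣p
  ... | inj₁ z≡p = inj₂ z≡p
  ... | inj₂ z∣q = inj₁ (∣-antisym z∣q q∣z)

  successor-∣ : ∀ {s t x} → IsSingularWithSuccessor s t → s ∣ x → ¬ x ≡ s → t ∣ x
  successor-∣ (_ , _ , above-s) s∣x x≢s with above-s _ s∣x
  ... | inj₁ x≡s = contradiction x≡s x≢s
  ... | inj₂ t∣x = t∣x

  ∣-sandwich⇒·≡ : ∀ {p s t} → s ∣ t → t ∣ (p · s) → p · t ≡ p · s
  ∣-sandwich⇒·≡ {p} {s} {t} s∣t t∣ps = begin
    p · t       ≡⟨ cong (p ·_) (∣⇒·≡ʳ s∣t) ⟨
    p · (s · t) ≡⟨ assoc p s t ⟨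
    (p · s) · t ≡⟨ comm (p · s) t ⟩
    t · (p · s) ≡⟨ ∣⇒·≡ʳ t∣ps ⟩
    p · s       ∎

  separatedEqualizers⇒notPredecessor : HasSeparatedEqualizers →
    ∀ {q p} → IsPredecessor q p → ¬ EqualizingPair q p
  separatedEqualizers⇒notPredecessor separated pred eq
    with separated _ _ eq
  ... | z , q∣z , z∣p , z≢q , z≢p with predecessor⇒noObjectBetween pred q∣z z∣p
  ... | inj₁ z≡q = z≢q z≡q
  ... | inj₂ z≡p = z≢p z≡p

  equalizingPair-of-fixed : ∀ {q p s t} → q ∣ p → q ∣ s → q ∣ t →
    ¬ s ≡ t → ¬ p · s ≡ s → p · s ≡ p · t → ¬ p · t ≡ t → EqualizingPair q p
  equalizingPair-of-fixed {q} {p} {s} {t} q∣p q∣s q∣t s≢t ps≢s ps≡pt pt≢t =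
    q∣p , s , t
      , (λ qs≡qt → s≢t (trans (sym qs≡s) (trans qs≡qt qt≡t)))
      , (λ qs≡ps → ps≢s (trans (sym qs≡ps) qs≡s))
      , ps≡pt
      , (λ pt≡qt → pt≢t (trans pt≡qt qt≡t))
    where
    qs≡s : q · s ≡ s
    qs≡s = ∣⇒·≡ʳ q∣s
    qt≡t : q · t ≡ t
    qt≡t = ∣⇒·≡ʳ q∣t

  ·-successor≡· : ∀ {p s t} → IsSingularWithSuccessor s t → ¬ p ∣ s → p · t ≡ p · s
  ·-successor≡· {p} {s} sing@(_ , s∣t , _) p∤s =
    ∣-sandwich⇒·≡ s∣t (successor-∣ sing (p , comm s p) (λ ps≡s → p∤s (s , ps≡s)))

  successor≡·-of-predecessor : DecidableEquality Carrier → HasSeparatedEqualizers →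
    ∀ {p q s t} → IsPredecessor q p → IsSingularWithSuccessor s t →
    q ∣ s → ¬ p ∣ s → t ≡ p · s
  successor≡·-of-predecessor _≟_ separated {p} {s = s} {t}
    pred@(_ , q∣p , _) sing@(t≢s , s∣t , _) q∣s p∤s with (p · t) ≟ t
  ... | yes pt≡t = trans (sym pt≡t) (·-successor≡· sing p∤s)
  ... | no pt≢t = contradiction
    (equalizingPair-of-fixed q∣p q∣s (∣-trans q∣s s∣t) (λ s≡t → t≢s (sym s≡t))
       (λ ps≡s → p∤s (s , ps≡s)) (sym (·-successor≡· sing p∤s)) pt≢t)
    (separatedEqualizers⇒notPredecessor separated pred)

mainTheorem13 : {c : Level} (M : Semilattice c) →
    let open Semilattice M in let open SemilatticeNotions M in
    IsFinite → HasSeparatedEqualizers →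
    (p q s t : Carrier) →
    Irreducible p → IsPredecessor q p → IsSingularWithSuccessor s t →
    q ∣ s → ¬ (p ∣ s) → t ≡ p · s
mainTheorem13 M finite separated _ _ _ _ _ =
  successor≡·-of-predecessor (finite⇒decidableEquality finite) separated
  where open SemilatticeProperties M
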